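{- Let $\alpha$ be a formula containing no points-to atom with $\mathcal{P}(\alpha)\subseteq\mathcal{P}_l$, and let $\alpha'$ be a decoration of $\alpha$. If $(s,h')\models_{\mathrm{Dec}(\mathcal{R})}\alpha'$ and $(s,h')\triangleright_{\mathrm{id}}(s,h)$, then $(s,h)\models_{\mathcal{R}}\alpha$.
   Context: Separation Logic: formulas from $x\not\approx x'$, $x\approx x'$, points-to atoms $x\mapsto(y_1,\dots,y_k)$ ($y_i$ variables or constant $\bot$), predicate atoms, $*$, $\vee$, $\exists$; SIDs are finite sets of rules $p(x_1..x_n)\Leftarrow\pi$ with $\pi$ quantifier-free separating conjunction of atoms; stores map variables and $\bot$ to locations $\mathcal{L}$ with $s(x)=\underline{\bot}$ iff $x=\bot$; heaps are finite partial maps from $\mathcal{L}\setminus\{\underline{\bot}\}$ to tuples; standard least-fixpoint semantics $\models$. $\mathcal{P}(\alpha)$: predicates reachable via rule bodies from those in $\alpha$. Standing setting: $\mathcal{R}$ is an SID with records of length $\kappa$ all of whose rules are progressing ($p(x_1..x_n)\Leftarrow x_1\mapsto(y_1..y_\kappa)*\rho$, no points-to in $\rho$); $\phi$ a quantifier-free formula, $\mathcal{P}_l=\mathcal{P}(\phi)$; $\mathbf{w}=(w_1..w_\nu)$, $\nu>0$, fixed variables not occurring in $\mathcal{R}$; every rule of $\mathcal{R}$ has exactly $\mu$ existential variables; for $p\in\mathcal{P}_l$, in every rule $p(x_1..x_n)\Leftarrow\pi$ and every atom $q(x'_1..x'_m)$ of $\pi$, $x'_1\notin\{x_1..x_n\}$.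 Stores have $w_1..w_\nu,\bot$ in their domain. $\underline{\boldsymbol{\bot}}$ is the $(\kappa+\nu+\mu)$-tuple of $\underline{\bot}$; the predicate $\mathsf{B}$ has the rule $\mathsf{B}(x)\Leftarrow x\mapsto(\bot,\dots,\bot)$ ($\kappa+\nu+\mu$ fields), included in the SIDs below. Decorations: for $n$-ary $p\in\mathcal{P}_l$ and $X\subseteq\{1..n\}$, $p_X$ is a fresh $(n+\nu)$-ary predicate. A decoration of a formula $\alpha$ without points-to atoms and with $\mathcal{P}(\alpha)\subseteq\mathcal{P}_l$ is obtained by replacing each atom $q(y_1..y_m)$ by some $q_{X}(y_1..y_m,\mathbf{w})$ with $X\subseteq\{1..m\}$ (chosen per atom). $\mathrm{Dec}(\mathcal{R})$ is the set of rules $p_X(x_1..x_n,\mathbf{w})\Leftarrow x_1\mapsto(y_1..y_\kappa,\mathbf{w},z_1..z_\mu)\sigma*\rho'*\mathop{*}_{i\in I}\mathsf{B}(z_i)$ where $p(x_1..x_n)\Leftarrow x_1\mapsto(y_1..y_\kappa)*\rho$ is in $\mathcal{R}$, $X\subseteq\{1..n\}$, $\{z_1..z_\mu\}=(\mathrm{fv}(\rho)\cup\{y_1..y_\kappa\})\setminus\{x_1..x_n\}$, $\sigma$ is a substitution with domain in $\{z_1..z_\mu\}$ and image in $\{x_1..x_n,w_1..w_\nu,z_1..z_\mu\}$, $\rho'$ is a decoration of $\rho\sigma$, and $I\subseteq\{1..\mu\}$ with $z_i\notin\mathrm{dom}(\sigma)$ for $i\in I$. Expansion $(s,h')\triangleright_{\mathrm{id}}(s,h)$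 for $h:\mathcal{L}\rightharpoonup\mathcal{L}^\kappa$, $h':\mathcal{L}\rightharpoonup\mathcal{L}^{\kappa+\nu+\mu}$: $h'=\mathrm{main}(h')\uplus\mathrm{aux}(h')$ with $\mathrm{dom}(\mathrm{main}(h'))=\mathrm{dom}(h)$; for $\ell\in\mathrm{dom}(\mathrm{main}(h'))$, $h'(\ell)=(h(\ell),s(\mathbf{w}),b_1..b_\mu)$ for some $b_i$; for $\ell\in\mathrm{dom}(\mathrm{aux}(h'))$, $h'(\ell)=\underline{\boldsymbol{\bot}}$ and $\ell$ is among the last $\mu$ components of $h'(\ell')$ for some $\ell'\in\mathrm{dom}(\mathrm{main}(h'))$. -}

module Defs where

open import Data.Nat using (ℕ; zero; suc; _+_)
open import Data.Fin using (Fin)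
open import Data.Fin.Subset using (Subset)
open import Data.Bool using (Bool; true; false)
open import Data.Vec using (Vec; []; _∷_; _++_; lookup; replicate; toList) renaming (map to vmap)
open import Data.List using (List; []; _∷_; foldl; concatMap) renaming (map to lmap; _++_ to _++ˡ_)
open import Data.List.Membership.Propositional using (_∈_; _∉_)
open import Data.Maybe using (Maybe; just; nothing)
open import Data.Product using (Σ; Σ-syntax; _×_; _,_)
open import Data.Sum using (_⊎_)
open import Data.Unit using (⊤)
open import Relation.Binary.PropositionalEquality using (_≡_; _≢_)
open import Relation.Nullary using (¬_)
open import Data.List.Relation.Binary.Pointwise using (Pointwise)
open import Function.Bundles using (_⇔_)

Loc : Set
Loc = ℕ

nilLoc : Loc
nilLoc = 0

Var : Set
Var = ℕ

data Term : Set where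
  v  : Var → Term
  ⊥t : Term

record Store : Set where
  field
    val   : Var → Loc
    valid : ∀ x → val x ≢ nilLoc
open Store public

⟦_⟧ : Term → Store → Loc
⟦ v x ⟧ s = val s x
⟦ ⊥t ⟧ s = nilLoc

record Heap (k : ℕ) : Set where
  field
    cell   : Loc → Maybe (Vec Loc k)
    finite : Σ[ d ∈ List Loc ] (∀ ℓ → cell ℓ ≢ nothing → ℓ ∈ d)
    nilOut : cell nilLoc ≡ nothing
open Heap public

Split : ∀ {k} → Heap k → Heap k → Heap k → Set
Split h h₁ h₂ = ∀ ℓ → (cell h ℓ ≡ cell h₁ ℓ × cell h₂ ℓ ≡ nothing)
                    ⊎ (cell h ℓ ≡ cell h₂ ℓ × cell h₁ ℓ ≡ nothing)

EmptyHeap : ∀ {k} → Heap k → Set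
EmptyHeap h = ∀ ℓ → cell h ℓ ≡ nothing

Singleton : ∀ {k} → Heap k → Loc → Vec Loc k → Set
Singleton h ℓ u = cell h ℓ ≡ just u × (∀ ℓ' → ℓ' ≢ ℓ → cell h ℓ' ≡ nothing)

record Sig : Set₁ where
  field
    Pr    : Set
    arity : Pr → ℕ
open Sig public

data Form (S : Sig) (k : ℕ) : Set where
  eqF neqF : Term → Term → Form S k
  pto      : Term → Vec Term k → Form S k
  predF    : (p : Pr S) → Vec Term (arity S p) → Form S k
  _⋆_ _∨F_ : Form S k → Form S k → Form S k
  ∃F       : Var → Form S k → Form S k

data Atom (S : Sig) : Set where
  eqA neqA : Term → Term → Atom S
  predA    : (p : Pr S) → Vec Term (arity S p) → Atom S

atomF : ∀ {S k} → Atom S → Form S k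
atomF (eqA t u)    = eqF t u
atomF (neqA t u)   = neqF t u
atomF (predA p ts) = predF p ts

mkBody : ∀ {S k} → Var → Vec Term k → List (Atom S) → Form S k
mkBody x tup ρ = foldl (λ acc a → acc ⋆ atomF a) (pto (v x) tup) ρ

record Rule (S : Sig) (k : ℕ) : Set where
  field
    pred   : Pr S
    params : Vec Var (arity S pred)
    body   : Form S k
open Rule public

-- Semantics (least fixpoint = inductive relation), for a set of rules

data Sat {S : Sig} {k : ℕ} (Rules : Rule S k → Set)
         : Store → Heap k → Form S k → Set where
  sat-eq  : ∀ {s h t u} → ⟦ t ⟧ s ≡ ⟦ u ⟧ s → EmptyHeap h → Sat Rules s h (eqF t u)
  sat-neq : ∀ {s h t u} → ⟦ t ⟧ s ≢ ⟦ u ⟧ s → EmptyHeap h → Sat Rules s h (neqF t u)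
  sat-pto : ∀ {s h t ys} → Singleton h (⟦ t ⟧ s) (vmap (λ y → ⟦ y ⟧ s) ys)
          → Sat Rules s h (pto t ys)
  sat-⋆   : ∀ {s h φ ψ} (h₁ h₂ : Heap k) → Split h h₁ h₂
          → Sat Rules s h₁ φ → Sat Rules s h₂ ψ → Sat Rules s h (φ ⋆ ψ)
  sat-∨l  : ∀ {s h φ ψ} → Sat Rules s h φ → Sat Rules s h (φ ∨F ψ)
  sat-∨r  : ∀ {s h φ ψ} → Sat Rules s h ψ → Sat Rules s h (φ ∨F ψ)
  sat-∃   : ∀ {s h x φ} (s' : Store) → (∀ y → y ≢ x → val s' y ≡ val s y)
          → Sat Rules s' h φ → Sat Rules s h (∃F x φ)
  sat-pred : ∀ {s h} (r : Rule S k) → Rules r → (ts : Vec Term (arity S (pred r)))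
           → (s' : Store)
           → (∀ i → val s' (lookup (params r) i) ≡ ⟦ lookup ts i ⟧ s)
           → Sat Rules s' h (body r)
           → Sat Rules s h (predF (pred r) ts)

varsT : Term → List Var
varsT (v x) = x ∷ []
varsT ⊥t    = []

varsTs : ∀ {n} → Vec Term n → List Var
varsTs ts = concatMap varsT (toList ts)

varsA : ∀ {S} → Atom S → List Var
varsA (eqA t u)    = varsT t ++ˡ varsT u
varsA (neqA t u)   = varsT t ++ˡ varsT u
varsA (predA p ts) = varsTs ts

varsF : ∀ {S k} → Form S k → List Var
varsF (eqF t u)   = varsT t ++ˡ varsT u
varsF (neqF t u)  = varsT t ++ˡ varsT u
varsF (pto t ts)  = varsT t ++ˡ varsTs ts
varsF (predF p ts) = varsTs ts
varsF (φ ⋆ ψ)     = varsF φ ++ˡ varsF ψ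
varsF (φ ∨F ψ)    = varsF φ ++ˡ varsF ψ
varsF (∃F x φ)    = x ∷ varsF φ

data PredOcc {S : Sig} {k : ℕ} : Form S k → (p : Pr S) → Vec Term (arity S p) → Set where
  here : ∀ {p ts} → PredOcc (predF p ts) p ts
  ⋆l   : ∀ {φ ψ p ts} → PredOcc φ p ts → PredOcc (φ ⋆ ψ) p ts
  ⋆r   : ∀ {φ ψ p ts} → PredOcc ψ p ts → PredOcc (φ ⋆ ψ) p ts
  ∨l   : ∀ {φ ψ p ts} → PredOcc φ p ts → PredOcc (φ ∨F ψ) p ts
  ∨r   : ∀ {φ ψ p ts} → PredOcc ψ p ts → PredOcc (φ ∨F ψ) p ts
  ∃o   : ∀ {x φ p ts} → PredOcc φ p ts → PredOcc (∃F x φ) p ts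

data Reach {S : Sig} {k : ℕ} (R : List (Rule S k)) : Pr S → Pr S → Set where
  reach-refl : ∀ {p} → Reach R p p
  reach-step : ∀ {q p'} (r : Rule S k) → r ∈ R → (ts : Vec Term (arity S q))
             → PredOcc (body r) q ts → Reach R q p' → Reach R (pred r) p'

InP : ∀ {S k} → List (Rule S k) → Form S k → Pr S → Set
InP {S} R α p = Σ[ q ∈ Pr S ] Σ[ ts ∈ Vec Term (arity S q) ] (PredOcc α q ts × Reach R q p)

data NoPto {S : Sig} {k : ℕ} : Form S k → Set where
  np-eq  : ∀ {t u} → NoPto (eqF t u)
  np-neq : ∀ {t u} → NoPto (neqF t u)
  np-pred : ∀ {p ts} → NoPto (predF p ts)
  np-⋆   : ∀ {φ ψ} → NoPto φ → NoPto ψ → NoPto (φ ⋆ ψ)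
  np-∨   : ∀ {φ ψ} → NoPto φ → NoPto ψ → NoPto (φ ∨F ψ)
  np-∃   : ∀ {x φ} → NoPto φ → NoPto (∃F x φ)

data QF {S : Sig} {k : ℕ} : Form S k → Set where
  qf-eq  : ∀ {t u} → QF (eqF t u)
  qf-neq : ∀ {t u} → QF (neqF t u)
  qf-pto : ∀ {t ts} → QF (pto t ts)
  qf-pred : ∀ {p ts} → QF (predF p ts)
  qf-⋆   : ∀ {φ ψ} → QF φ → QF ψ → QF (φ ⋆ ψ)
  qf-∨   : ∀ {φ ψ} → QF φ → QF ψ → QF (φ ∨F ψ)

ExVarsEnum : ∀ {S n k μ} → Vec Var n → Vec Term k → List (Atom S) → Vec Var μ → Set
ExVarsEnum xs ys ρ zs =
  (∀ i j → lookup zs i ≡ lookup zs j → i ≡ j) ×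
  (∀ y → (y ∈ toList zs) ⇔ ((y ∈ varsTs ys ⊎ y ∈ concatMap varsA ρ) × y ∉ toList xs))

data HeadIs {A : Set} : ∀ {n} → Vec A n → A → Set where
  headIs : ∀ {n x} {xs : Vec A n} → HeadIs (x ∷ xs) x

ProgressingWith : ∀ {S k} → ℕ → Rule S k → Set
ProgressingWith {S} {k} μ r =
  Σ[ x₁ ∈ Var ] Σ[ ys ∈ Vec Term k ] Σ[ ρ ∈ List (Atom S) ]
    (body r ≡ mkBody x₁ ys ρ × HeadIs (params r) x₁ ×
     Σ[ zs ∈ Vec Var μ ] ExVarsEnum (params r) ys ρ zs)

FirstArgNotIn : ∀ {n m} → Vec Term n → Vec Var m → Set
FirstArgNotIn []       xs = ⊤
FirstArgNotIn (t ∷ ts) xs = ∀ x → t ≡ v x → x ∉ toList xs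

data DPr (S : Sig) : Set where
  dec : (p : Pr S) → Subset (arity S p) → DPr S
  B   : DPr S

DSig : Sig → ℕ → Sig
DSig S ν = record { Pr = DPr S ; arity = ar }
  where
  ar : DPr S → ℕ
  ar (dec p X) = arity S p + ν
  ar B         = 1

module _ {S : Sig} {ν : ℕ} (w : Vec Var ν) where

  wT : Vec Term ν
  wT = vmap v w

  data DecAtom : Atom S → Atom (DSig S ν) → Set where
    da-eq   : ∀ {t u} → DecAtom (eqA t u) (eqA t u)
    da-neq  : ∀ {t u} → DecAtom (neqA t u) (neqA t u)
    da-pred : ∀ {p ts} (X : Subset (arity S p)) → DecAtom (predA p ts) (predA (dec p X) (ts ++ wT))

  data DecForm {k k' : ℕ} : Form S k → Form (DSig S ν) k' → Set where
    df-eq   : ∀ {t u} → DecForm (eqF t u) (eqF t u)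
    df-neq  : ∀ {t u} → DecForm (neqF t u) (neqF t u)
    df-pred : ∀ {p ts} (X : Subset (arity S p)) → DecForm (predF p ts) (predF (dec p X) (ts ++ wT))
    df-⋆    : ∀ {φ ψ φ' ψ'} → DecForm φ φ' → DecForm ψ ψ' → DecForm (φ ⋆ ψ) (φ' ⋆ ψ')
    df-∨    : ∀ {φ ψ φ' ψ'} → DecForm φ φ' → DecForm ψ ψ' → DecForm (φ ∨F ψ) (φ' ∨F ψ')
    df-∃    : ∀ {x φ φ'} → DecForm φ φ' → DecForm (∃F x φ) (∃F x φ')

substT : (Var → Var) → Term → Term
substT σ (v x) = v (σ x)
substT σ ⊥t    = ⊥t

substA : ∀ {S} → (Var → Var) → Atom S → Atom S
substA σ (eqA t u)    = eqA (substT σ t) (substT σ u)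
substA σ (neqA t u)   = neqA (substT σ t) (substT σ u)
substA σ (predA p ts) = predA p (vmap (substT σ) ts)

bAtoms : ∀ {S ν n} → Vec Var n → Subset n → List (Atom (DSig S ν))
bAtoms []       []          = []
bAtoms (z ∷ zs) (true ∷ I)  = predA B (v z ∷ []) ∷ bAtoms zs I
bAtoms (z ∷ zs) (false ∷ I) = bAtoms zs I

data DecRules {S : Sig} {κ ν μ : ℕ} (w : Vec Var ν) (R : List (Rule S κ))
     : Rule (DSig S ν) (κ + ν + μ) → Set where
  dec-rule :
    (r : Rule S κ) → r ∈ R →
    (x₁ : Var) (ys : Vec Term κ) (ρ : List (Atom S)) →
    body r ≡ mkBody x₁ ys ρ → HeadIs (params r) x₁ →
    (X : Subset (arity S (pred r))) →
    (zs : Vec Var μ) → ExVarsEnum (params r) ys ρ zs →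
    (σ : Var → Var) →
    (∀ y → σ y ≢ y → y ∈ toList zs × σ y ∈ toList ((params r ++ w) ++ zs)) →
    (ρ' : List (Atom (DSig S ν))) →
    Pointwise (DecAtom w) (lmap (substA σ) ρ) ρ' →
    (I : Subset μ) →
    (∀ i → lookup I i ≡ true → σ (lookup zs i) ≡ lookup zs i) →
    DecRules w R (record
      { pred   = dec (pred r) X
      ; params = params r ++ w
      ; body   = mkBody x₁ (vmap (substT σ) ((ys ++ vmap v w) ++ vmap v zs))
                           (ρ' ++ˡ bAtoms zs I) })
  b-rule : DecRules w R (record { pred = B ; params = 0 ∷ [] ; body = pto (v 0) (replicate _ ⊥t) })

Expand : ∀ {κ ν μ} → Vec Var ν → Store → Heap (κ + ν + μ) → Heap κ → Set
Expand {κ} {ν} {μ} w s h' h =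
  Σ[ mn ∈ Heap (κ + ν + μ) ] Σ[ ax ∈ Heap (κ + ν + μ) ]
    (Split h' mn ax ×
     (∀ ℓ → cell mn ℓ ≡ nothing ⇔ cell h ℓ ≡ nothing) ×
     (∀ ℓ t → cell mn ℓ ≡ just t →
        Σ[ u ∈ Vec Loc κ ] Σ[ bs ∈ Vec Loc μ ]
          (cell h ℓ ≡ just u × t ≡ (u ++ vmap (val s) w) ++ bs)) ×
     (∀ ℓ t → cell ax ℓ ≡ just t →
        t ≡ replicate _ nilLoc ×
        Σ[ ℓ' ∈ Loc ] Σ[ u ∈ Vec Loc (κ + ν) ] Σ[ bs ∈ Vec Loc μ ]
          (cell mn ℓ' ≡ just (u ++ bs) × ℓ ∈ toList bs)))

module Submission where

open import Defs
open import Data.Nat using (ℕ; _+_; _>_; _≟_)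
open import Data.Fin using (Fin; _↑ˡ_; _↑ʳ_; fromℕ<)
open import Data.Vec using (Vec; []; _∷_; _++_; lookup; toList; replicate) renaming (map to vmap)
open import Data.Vec.Properties using (map-++; map-cong; map-∘; lookup-map; ++-injectiveˡ; lookup-++ˡ; lookup-++ʳ; lookup-replicate; map-replicate)
open import Data.Vec.Membership.Propositional.Properties using (∈-lookup; ∈-toList⁺)
open import Data.List using (List; []; _∷_; foldl) renaming (map to lmap; _++_ to _++ˡ_)
open import Data.List.Properties using (foldl-++)
open import Data.List.Membership.Propositional using (_∈_; _∉_)
open import Data.List.Relation.Unary.Any using (here)
open import Data.List.Relation.Binary.Pointwise using (Pointwise; []; _∷_)
open import Data.Maybe using (Maybe; just; nothing; _>>=_)
open import Data.Maybe.Properties using (just-injective)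
open import Data.Product using (_×_; _,_; proj₁; proj₂; Σ-syntax)
open import Data.Sum using (_⊎_; inj₁; inj₂)
open import Data.Bool using (true; false)
open import Data.Empty using (⊥-elim)
open import Relation.Nullary using (yes; no)
open import Relation.Binary.PropositionalEquality
open import Function.Bundles using (Equivalence; _⇔_)

-- The expansion relates h' and h cell by cell: a cell is empty in both, a
-- ⊥-record of h' absent from h, or a main record (u, s(w), bs) of h' over the
-- record u of h. This relation is inherited by the parts of any splitting of
-- h', so a derivation of α' in Dec(ℛ) can be replayed in ℛ on h: the copies of
-- the w's and the existential variables are forgotten, the B-atoms only
-- consume ⊥-records, and main records are never ⊥-records because a store maps
-- no variable (in particular no w_i, and ν > 0) to ⊥.

_∘ˢ_ : Store → (Var → Var) → Store
s ∘ˢ σ = record { val = λ x → val s (σ x) ; valid = λ x → valid s (σ x) }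

⟦substT⟧ : ∀ (σ : Var → Var) (s : Store) t → ⟦ substT σ t ⟧ s ≡ ⟦ t ⟧ (s ∘ˢ σ)
⟦substT⟧ σ s (v x) = refl
⟦substT⟧ σ s ⊥t    = refl

HeadIs⇒∈ : ∀ {A : Set} {n} {xs : Vec A n} {x} → HeadIs xs x → x ∈ toList xs
HeadIs⇒∈ headIs = here refl

>>=-const-nothing : ∀ {A B : Set} (a : Maybe A) {b : Maybe B} → b ≡ nothing → (a >>= λ _ → b) ≡ nothing
>>=-const-nothing nothing  _ = refl
>>=-const-nothing (just _) e = e

-- h restricted to the domain of h' (whose records may have another length)
restrictTo : ∀ {k k'} → Heap k' → Heap k → Heap k
restrictTo h' h = record
  { cell   = λ ℓ → cell h' ℓ >>= λ _ → cell h ℓ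
  ; finite = proj₁ (finite h) , λ ℓ ne → proj₂ (finite h) ℓ (λ e → ne (>>=-const-nothing (cell h' ℓ) e))
  ; nilOut = >>=-const-nothing (cell h' nilLoc) (nilOut h) }

module Erasure {κ ν μ : ℕ} (W : Vec Loc ν) (i₀ : Fin ν) (W[i₀]≢⊥ : lookup W i₀ ≢ nilLoc) where

  K : ℕ
  K = κ + ν + μ

  ⊥-record : Vec Loc K
  ⊥-record = replicate K nilLoc

  main≢⊥-record : ∀ (u : Vec Loc κ) ws (bs : Vec Loc μ) → lookup ws i₀ ≢ nilLoc → (u ++ ws) ++ bs ≢ ⊥-record
  main≢⊥-record u ws bs ws[i₀]≢⊥ e = ws[i₀]≢⊥ (begin
      lookup ws i₀                            ≡⟨ lookup-++ʳ u ws i₀ ⟨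
      lookup (u ++ ws) (κ ↑ʳ i₀)              ≡⟨ lookup-++ˡ (u ++ ws) bs (κ ↑ʳ i₀) ⟨
      lookup ((u ++ ws) ++ bs) ((κ ↑ʳ i₀) ↑ˡ μ) ≡⟨ cong (λ t → lookup t ((κ ↑ʳ i₀) ↑ˡ μ)) e ⟩
      lookup ⊥-record ((κ ↑ʳ i₀) ↑ˡ μ)          ≡⟨ lookup-replicate ((κ ↑ʳ i₀) ↑ˡ μ) nilLoc ⟩
      nilLoc                                  ∎)
    where open ≡-Reasoning

  data Erases : Maybe (Vec Loc K) → Maybe (Vec Loc κ) → Set where
    empty : Erases nothing nothing
    aux   : Erases (just ⊥-record) nothing
    main  : ∀ u bs → Erases (just ((u ++ W) ++ bs)) (just u)

  record Erasure (h' : Heap K) (h : Heap κ) : Set where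
    constructor mkErasure
    field erases : ∀ ℓ → Erases (cell h' ℓ) (cell h ℓ)
  open Erasure public

  erases-nothing : ∀ {a' a} → Erases a' a → a' ≡ nothing → a ≡ nothing
  erases-nothing empty _ = refl

  erasure-empty : ∀ {h' h} → Erasure h' h → EmptyHeap h' → EmptyHeap h
  erasure-empty (mkErasure e) emp ℓ = erases-nothing (e ℓ) (emp ℓ)

  erases-main : ∀ {a' a} (u : Vec Loc κ) ws bs → lookup ws i₀ ≢ nilLoc →
    Erases a' a → a' ≡ just ((u ++ ws) ++ bs) → a ≡ just u
  erases-main u ws bs ws[i₀]≢⊥ aux e = ⊥-elim (main≢⊥-record u ws bs ws[i₀]≢⊥ (sym (just-injective e)))
  erases-main u ws bs _ (main u' bs') e =
    cong just (++-injectiveˡ u' u (++-injectiveˡ (u' ++ W) (u ++ ws) (just-injective e)))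

  private
    CellSplit : ∀ {A : Set} → Maybe A → Maybe A → Maybe A → Set
    CellSplit a a₁ a₂ = (a ≡ a₁ × a₂ ≡ nothing) ⊎ (a ≡ a₂ × a₁ ≡ nothing)

    _↾_ : Maybe (Vec Loc K) → Maybe (Vec Loc κ) → Maybe (Vec Loc κ)
    a' ↾ a = a' >>= λ _ → a

  erases-split : ∀ {a' a₁ a₂ a} → CellSplit a' a₁ a₂ → Erases a' a →
    CellSplit a (a₁ ↾ a) (a₂ ↾ a) × Erases a₁ (a₁ ↾ a) × Erases a₂ (a₂ ↾ a)
  erases-split {a₁ = nothing} (inj₁ (refl , refl)) er = inj₁ (erases-nothing er refl , refl) , empty , empty
  erases-split {a₁ = just _}  (inj₁ (refl , refl)) er = inj₁ (refl , refl) , er , empty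
  erases-split {a₂ = nothing} (inj₂ (refl , refl)) er = inj₂ (erases-nothing er refl , refl) , empty , empty
  erases-split {a₂ = just _}  (inj₂ (refl , refl)) er = inj₂ (refl , refl) , empty , er

  erasure-split : ∀ {h' h'₁ h'₂ h} → Split h' h'₁ h'₂ → Erasure h' h →
    Split h (restrictTo h'₁ h) (restrictTo h'₂ h) × Erasure h'₁ (restrictTo h'₁ h) × Erasure h'₂ (restrictTo h'₂ h)
  erasure-split sp (mkErasure e) =
      (λ ℓ → proj₁ (erases-split (sp ℓ) (e ℓ)))
    , mkErasure (λ ℓ → proj₁ (proj₂ (erases-split (sp ℓ) (e ℓ))))
    , mkErasure (λ ℓ → proj₂ (proj₂ (erases-split (sp ℓ) (e ℓ))))

  erases-drop-aux : ∀ {a' a₁ a₂ a} → CellSplit a' a₁ a₂ → Erases a' a →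
    (∀ t → a₂ ≡ just t → t ≡ ⊥-record) → Erases a₁ a
  erases-drop-aux (inj₁ (refl , refl)) er _ = er
  erases-drop-aux (inj₂ (refl , refl)) empty _ = empty
  erases-drop-aux (inj₂ (refl , refl)) aux _ = empty
  erases-drop-aux (inj₂ (refl , refl)) (main u bs) only⊥ = ⊥-elim (main≢⊥-record u W bs W[i₀]≢⊥ (only⊥ _ refl))

  erases-expansion : ∀ {a' m x a} → CellSplit a' m x →
    (m ≡ nothing) ⇔ (a ≡ nothing) →
    (∀ t → m ≡ just t → Σ[ u ∈ Vec Loc κ ] Σ[ bs ∈ Vec Loc μ ] (a ≡ just u × t ≡ (u ++ W) ++ bs)) →
    (∀ t → x ≡ just t → t ≡ ⊥-record) →
    Erases a' a
  erases-expansion {m = nothing} (inj₁ (refl , refl)) dom _ _ rewrite Equivalence.to dom refl = empty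
  erases-expansion {m = just t}  (inj₁ (refl , refl)) _ main-shape _ with main-shape t refl
  ... | u , bs , refl , refl = main u bs
  erases-expansion {x = nothing} (inj₂ (refl , refl)) dom _ _ rewrite Equivalence.to dom refl = empty
  erases-expansion {x = just t}  (inj₂ (refl , refl)) dom _ aux-shape
    rewrite Equivalence.to dom refl | aux-shape t refl = aux

  module Replay {S : Sig} (w : Vec Var ν) (R : List (Rule S κ)) where

    Sat' : Store → Heap K → Form (DSig S ν) K → Set
    Sat' = Sat (DecRules {S} {κ} {ν} {μ} w R)

    Satℛ : Store → Heap κ → Form S κ → Set
    Satℛ = Sat (λ r → r ∈ R)

    _⋆atom_ : ∀ {T k} → Form T k → Atom T → Form T k
    F ⋆atom a = F ⋆ atomF a

    -- DecBody σ F G: F is a prefix of the body of a rule of Dec(ℛ) built with σ,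
    -- and G the corresponding prefix of the body of the underlying rule of ℛ.
    data DecBody (σ : Var → Var) : Form (DSig S ν) K → Form S κ → Set where
      pto   : ∀ x₁ (ys : Vec Term κ) (zs : Vec Var μ) → σ x₁ ≡ x₁ →
              DecBody σ (pto (v x₁) (vmap (substT σ) ((ys ++ vmap v w) ++ vmap v zs))) (pto (v x₁) ys)
      _⋆_   : ∀ {F G a a'} → DecBody σ F G → DecAtom w (substA σ a) a' → DecBody σ (F ⋆atom a') (G ⋆atom a)
      _⋆B_  : ∀ {F G} → DecBody σ F G → ∀ z → DecBody σ (F ⋆ predF B (v z ∷ [])) G

    decBody-atoms : ∀ {σ F G} ρ ρ' → Pointwise (DecAtom w) (lmap (substA σ) ρ) ρ' → DecBody σ F G →
      DecBody σ (foldl _⋆atom_ F ρ') (foldl _⋆atom_ G ρ)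
    decBody-atoms []      []        []         d = d
    decBody-atoms (_ ∷ ρ) (_ ∷ ρ') (da ∷ das) d = decBody-atoms ρ ρ' das (d ⋆ da)

    decBody-Bs : ∀ {σ F G n} (zs : Vec Var n) I → DecBody σ F G →
      DecBody σ (foldl _⋆atom_ F (bAtoms {S} {ν} zs I)) G
    decBody-Bs []       []          d = d
    decBody-Bs (z ∷ zs) (true ∷ I)  d = decBody-Bs zs I (d ⋆B z)
    decBody-Bs (z ∷ zs) (false ∷ I) d = decBody-Bs zs I d

    B-cells-⊥ : ∀ {s h z} → Sat' s h (predF B (v z ∷ [])) → ∀ ℓ t → cell h ℓ ≡ just t → t ≡ ⊥-record
    B-cells-⊥ (sat-pred _ b-rule _ _ _ (sat-pto {s = s₁} (at , elsewhere))) ℓ t e with ℓ ≟ val s₁ 0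
    ... | yes refl = trans (just-injective (trans (sym e) at)) (map-replicate (λ y → ⟦ y ⟧ s₁) ⊥t K)
    ... | no ℓ≢ with () ← trans (sym e) (elsewhere ℓ ℓ≢)

    satℛ-pred-subst : ∀ {s h p σ} (ts : Vec Term (arity S p)) →
      Satℛ s h (predF p (vmap (substT σ) ts)) → Satℛ (s ∘ˢ σ) h (predF p ts)
    satℛ-pred-subst {s} {σ = σ} ts (sat-pred r r∈R _ s₀ args d) =
      sat-pred r r∈R ts s₀ (λ i → begin
        val s₀ (lookup (params r) i)     ≡⟨ args i ⟩
        ⟦ lookup (vmap (substT σ) ts) i ⟧ s ≡⟨ cong (λ t → ⟦ t ⟧ s) (lookup-map i (substT σ) ts) ⟩
        ⟦ substT σ (lookup ts i) ⟧ s     ≡⟨ ⟦substT⟧ σ s (lookup ts i) ⟩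
        ⟦ lookup ts i ⟧ (s ∘ˢ σ)         ∎) d
      where open ≡-Reasoning

    mutual
      replay-pred : ∀ {s h' h p X ts} → Sat' s h' (predF (dec p X) (ts ++ vmap v w)) → Erasure h' h →
        Satℛ s h (predF p ts)
      replay-pred {s} {h = h} {ts = ts}
        (sat-pred _ (dec-rule r r∈R x₁ ys ρ body≡ head _ zs exVars σ σ-moves ρ' ρ'-dec I _) _ s' args d) er =
        sat-pred r r∈R ts (s' ∘ˢ σ) args′
          (subst (Satℛ (s' ∘ˢ σ) h) (sym body≡) (replay-body decBody d er))
        where
        σ-fixes-params : ∀ {y} → y ∈ toList (params r) → σ y ≡ y
        σ-fixes-params {y} y∈ with σ y ≟ y
        ... | yes fixed = fixed
        ... | no moved = ⊥-elim (proj₂ (Equivalence.to (proj₂ exVars y) (proj₁ (σ-moves y moved))) y∈)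

        args′ : ∀ i → val s' (σ (lookup (params r) i)) ≡ ⟦ lookup ts i ⟧ s
        args′ i = begin
          val s' (σ (lookup (params r) i))           ≡⟨ cong (val s') (σ-fixes-params (∈-toList⁺ (∈-lookup i (params r)))) ⟩
          val s' (lookup (params r) i)               ≡⟨ cong (val s') (lookup-++ˡ (params r) w i) ⟨
          val s' (lookup (params r ++ w) (i ↑ˡ _))   ≡⟨ args (i ↑ˡ _) ⟩
          ⟦ lookup (ts ++ vmap v w) (i ↑ˡ _) ⟧ s     ≡⟨ cong (λ t → ⟦ t ⟧ s) (lookup-++ˡ ts (vmap v w) i) ⟩
          ⟦ lookup ts i ⟧ s                          ∎
          where open ≡-Reasoning

        pto₀ : Form (DSig S ν) K
        pto₀ = pto (v x₁) (vmap (substT σ) ((ys ++ vmap v w) ++ vmap v zs))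

        decBody : DecBody σ (mkBody x₁ (vmap (substT σ) ((ys ++ vmap v w) ++ vmap v zs)) (ρ' ++ˡ bAtoms zs I))
                            (mkBody x₁ ys ρ)
        decBody = subst (λ F → DecBody σ F (mkBody x₁ ys ρ)) (sym (foldl-++ _⋆atom_ pto₀ ρ' (bAtoms zs I)))
          (decBody-Bs zs I (decBody-atoms ρ ρ' ρ'-dec (pto x₁ ys zs (σ-fixes-params (HeadIs⇒∈ head)))))

      replay-atom : ∀ {s' h' h σ} a {a'} → DecAtom w (substA σ a) a' → Sat' s' h' (atomF a') → Erasure h' h →
        Satℛ (s' ∘ˢ σ) h (atomF a)
      replay-atom {s'} {σ = σ} (eqA t u) da-eq (sat-eq e emp) er =
        sat-eq (trans (sym (⟦substT⟧ σ s' t)) (trans e (⟦substT⟧ σ s' u))) (erasure-empty er emp)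
      replay-atom {s'} {σ = σ} (neqA t u) da-neq (sat-neq e emp) er =
        sat-neq (λ e' → e (trans (⟦substT⟧ σ s' t) (trans e' (sym (⟦substT⟧ σ s' u))))) (erasure-empty er emp)
      replay-atom (predA p ts) (da-pred X) d er = satℛ-pred-subst ts (replay-pred d er)

      replay-body : ∀ {σ F G s' h' h} → DecBody σ F G → Sat' s' h' F → Erasure h' h → Satℛ (s' ∘ˢ σ) h G
      replay-body {σ} {s' = s'} {h = h} (pto x₁ ys zs σx₁≡) (sat-pto (at , elsewhere)) (mkErasure er) =
        sat-pto (subst (λ y → cell h (val s' y) ≡ just u) (sym σx₁≡) at-x₁ , elsewhere′)
        where
        ⟦σ_⟧ : Term → Loc
        ⟦σ t ⟧ = ⟦ substT σ t ⟧ s'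
        u : Vec Loc κ
        u = vmap (λ y → ⟦ y ⟧ (s' ∘ˢ σ)) ys
        ws : Vec Loc ν
        ws = vmap ⟦σ_⟧ (vmap v w)
        bs : Vec Loc μ
        bs = vmap ⟦σ_⟧ (vmap v zs)

        record≡ : vmap (λ y → ⟦ y ⟧ s') (vmap (substT σ) ((ys ++ vmap v w) ++ vmap v zs)) ≡ (u ++ ws) ++ bs
        record≡ = trans (sym (map-∘ _ (substT σ) ((ys ++ vmap v w) ++ vmap v zs)))
                 (trans (map-++ ⟦σ_⟧ (ys ++ vmap v w) (vmap v zs))
                 (cong (_++ bs) (trans (map-++ ⟦σ_⟧ ys (vmap v w)) (cong (_++ ws) (map-cong (⟦substT⟧ σ s') ys)))))

        ws[i₀]≢⊥ : lookup ws i₀ ≢ nilLoc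
        ws[i₀]≢⊥ e = valid s' (σ (lookup w i₀))
          (trans (sym (trans (lookup-map i₀ ⟦σ_⟧ (vmap v w)) (cong ⟦σ_⟧ (lookup-map i₀ v w)))) e)

        at-x₁ : cell h (val s' x₁) ≡ just u
        at-x₁ = erases-main u ws bs ws[i₀]≢⊥ (er (val s' x₁)) (trans at (cong just record≡))

        elsewhere′ : ∀ ℓ → ℓ ≢ val s' (σ x₁) → cell h ℓ ≡ nothing
        elsewhere′ ℓ ℓ≢ = erases-nothing (er ℓ) (elsewhere ℓ (λ e → ℓ≢ (trans e (cong (val s') (sym σx₁≡)))))
      replay-body {h = h} (_⋆_ {a = a} d da) (sat-⋆ h'₁ h'₂ sp d₁ d₂) er with erasure-split sp er
      ... | sp′ , er₁ , er₂ =
        sat-⋆ (restrictTo h'₁ h) (restrictTo h'₂ h) sp′ (replay-body d d₁ er₁) (replay-atom a da d₂ er₂)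
      replay-body (d ⋆B _) (sat-⋆ _ _ sp d₁ d₂) (mkErasure er) =
        replay-body d d₁ (mkErasure (λ ℓ → erases-drop-aux (sp ℓ) (er ℓ) (B-cells-⊥ d₂ ℓ)))

    replay : ∀ {α α' s h' h} → DecForm w α α' → Sat' s h' α' → Erasure h' h → Satℛ s h α
    replay df-eq  (sat-eq e emp)  er = sat-eq e (erasure-empty er emp)
    replay df-neq (sat-neq e emp) er = sat-neq e (erasure-empty er emp)
    replay (df-pred X) d er = replay-pred d er
    replay {h = h} (df-⋆ dα dβ) (sat-⋆ h'₁ h'₂ sp d₁ d₂) er with erasure-split sp er
    ... | sp′ , er₁ , er₂ = sat-⋆ (restrictTo h'₁ h) (restrictTo h'₂ h) sp′ (replay dα d₁ er₁) (replay dβ d₂ er₂)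
    replay (df-∨ dα _) (sat-∨l d) er = sat-∨l (replay dα d er)
    replay (df-∨ _ dβ) (sat-∨r d) er = sat-∨r (replay dβ d er)
    replay (df-∃ dα) (sat-∃ s' agree d) er = sat-∃ s' agree (replay dα d er)

lemma6 : (S : Sig) (κ ν μ : ℕ) → ν > 0 → (w : Vec Var ν)
    → (R : List (Rule S κ))
    → (∀ r → r ∈ R → ProgressingWith μ r)
    → (∀ r → r ∈ R → ∀ i → lookup w i ∉ toList (params r) × lookup w i ∉ varsF (body r))
    → (φ : Form S κ) → QF φ
    → (∀ r → r ∈ R → InP R φ (pred r)
    → ∀ q ts → PredOcc (body r) q ts → FirstArgNotIn ts (params r))
    → (α : Form S κ) → NoPto α → (∀ p → InP R α p → InP R φ p)
    → (α' : Form (DSig S ν) (κ + ν + μ)) → DecForm w α α'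
    → (s : Store) (h : Heap κ) (h' : Heap (κ + ν + μ))
    → Sat (DecRules w R) s h' α'
    → Expand w s h' h
    → Sat (λ r → r ∈ R) s h α
lemma6 S κ ν μ ν>0 w R _ _ φ _ _ α _ _ α' dα s h h' sat (_ , _ , sp , dom , main-shape , aux-shape) =
  replay dα sat (mkErasure λ ℓ → erases-expansion (sp ℓ) (dom ℓ) (main-shape ℓ) (λ t e → proj₁ (aux-shape ℓ t e)))
  where
  i₀ : Fin ν
  i₀ = fromℕ< ν>0
  open Erasure {κ} {ν} {μ} (vmap (val s) w) i₀ (λ e → valid s (lookup w i₀) (trans (sym (lookup-map i₀ (val s) w)) e))
  open Replay w R
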